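{- For every $f\in\overleftarrow{QR}$, \[ \eta_0(f)(\mathbf x_+)=\lim_{b\to\infty}\pi_+(\gamma^b(f)), \] where the limit is taken coefficientwise (for each fixed monomial, its coefficient eventually stabilizes).
   Context: Variables $\mathbf{x}=\{x_i: i\in\mathbb{Z}\}$, $\mathbf x_-=\{x_i:i\le 0\}$, $\mathbf x_+=\{x_i:i\ge1\}$. $\mathrm{QSym}$ denotes the quasisymmetric functions in $\mathbf x_-$ (bounded-degree series in $\mathbf x_-$ whose coefficient of $x_{i_1}^{\alpha_1}\cdots x_{i_k}^{\alpha_k}$, $i_1<\cdots<i_k\le0$, depends only on $(\alpha_1,\dots,\alpha_k)$). $\overleftarrow{QR}$ is the space of back quasisymmetric functions: bounded-degree series $f\in\mathbb{Q}[[\mathbf x]]$ involving no $x_i$ for $i$ larger than some $N$, for which there is $b\in\mathbb{Z}$ such that for all positive integers $(a_1,\dots,a_k)$ and all monomials $\mathsf m$ in $\{x_i:i>b\}$, the coefficient of $x_{i_1}^{a_1}\cdots x_{i_k}^{a_k}\mathsf m$ is the same for all $i_1<\cdots<i_k\le b$. Every $f\in\overleftarrow{QR}$ can be written uniquely as a finite sum $f=\sum_{\mathbf c}g_{\mathbf c}\,\mathbf x^{\mathbf c}$ with $g_{\mathbf c}\in\mathrm{QSym}$ and $\mathbf x^{\mathbf c}$ distinct monomials in $\mathbb{Q}[\mathbf x]$; $\eta_0(f)\in\mathrm{QSym}$ is the coefficient $g_{\mathbf 0}$ of the monomial $1$. $\eta_0(f)(\mathbf x_+)$ denotes the image of $\eta_0(f)$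 under the isomorphism from quasisymmetric functions in $\mathbf x_-$ to those in $\mathbf x_+$ induced by the order-preserving identification of the ordered alphabets $\mathbf x_-$ and $\mathbf x_+$ (matching monomials with the same composition of exponents). $\gamma$ is the shift $x_i\mapsto x_{i+1}$ for all $i\in\mathbb{Z}$, and $\pi_+$ sets $x_i=0$ for all $i\le0$. -}

module Defs where

open import Data.Nat as ℕ using (ℕ; zero; suc)
open import Data.Integer as ℤ using (ℤ; +_; -_)
open import Data.Rational as ℚ using (ℚ; 0ℚ)
open import Data.List using (List; []; _∷_; map; foldr; length; _++_)
open import Data.List.Relation.Unary.All using (All; all?)
open import Data.List.Relation.Unary.Any using (Any)
open import Data.List.Relation.Unary.Unique.Propositional using (Unique)
open import Data.Product using (_×_; _,_; proj₁; proj₂; ∃)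
open import Data.Unit using (⊤)
open import Data.Maybe using (Maybe; just; nothing; maybe)
open import Data.Bool using (if_then_else_)
open import Relation.Nullary using (yes; no)
open import Relation.Nullary.Decidable using (⌊_⌋)
open import Relation.Binary.PropositionalEquality using (_≡_)

-- A monomial x_{i_1}^{a_1} ⋯ x_{i_k}^{a_k} (i ∈ ℤ) is represented canonically
-- by the list ((i_1 , a_1) ∷ … ∷ (i_k , a_k)) with i_1 < ⋯ < i_k and a_j ≥ 1.
Mon : Set
Mon = List (ℤ × ℕ)

Above : ℤ → Mon → Set
Above i []             = ⊤
Above i ((j , _) ∷ _) = i ℤ.< j

ValidMon : Mon → Set
ValidMon []             = ⊤
ValidMon ((i , a) ∷ m) = (1 ℕ.≤ a) × Above i m × ValidMon m

indices : Mon → List ℤ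
indices = map proj₁

exps : Mon → List ℕ
exps = map proj₂

degree : Mon → ℕ
degree m = foldr ℕ._+_ 0 (exps m)

Series : Set
Series = Mon → ℚ

BoundedDegree : Series → Set
BoundedDegree f = ∃ λ D → ∀ m → ValidMon m → D ℕ.< degree m → f m ≡ 0ℚ

NoVarAbove : ℤ → Series → Set
NoVarAbove N f = ∀ m → ValidMon m → Any (λ i → N ℤ.< i) (indices m) → f m ≡ 0ℚ

IsQSym : Series → Set
IsQSym g = BoundedDegree g × NoVarAbove (+ 0) g
  × (∀ m m' → ValidMon m → ValidMon m'
       → All (ℤ._≤ + 0) (indices m) → All (ℤ._≤ + 0) (indices m')
       → exps m ≡ exps m' → g m ≡ g m')

IsBackQR : Series → Set
IsBackQR f = BoundedDegree f × (∃ λ N → NoVarAbove N f)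
  × (∃ λ b → ∀ p p' q → ValidMon p → ValidMon p' → ValidMon q
       → All (ℤ._≤ b) (indices p) → All (ℤ._≤ b) (indices p')
       → All (b ℤ.<_) (indices q)
       → exps p ≡ exps p' → f (p ++ q) ≡ f (p' ++ q))

divMon : Mon → Mon → Maybe Mon
divMon m [] = just m
divMon [] (_ ∷ _) = nothing
divMon ((i , a) ∷ m) ((j , b) ∷ c) with i ℤ.<? j | i ℤ.≟ j
... | yes _ | _ = Data.Maybe.map ((i , a) ∷_) (divMon m ((j , b) ∷ c))
... | no _ | no _ = nothing
... | no _ | yes _ with b ℕ.≤? a
...   | no _ = nothing
...   | yes _ with a ℕ.∸ b
...     | zero = divMon m c
...     | suc d = Data.Maybe.map ((i , suc d) ∷_) (divMon m c)

mulMonCoeff : Mon → Series → Series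
mulMonCoeff c g m = maybe g 0ℚ (divMon m c)

IsQSymExpansion : Series → List (Mon × Series) → Set
IsQSymExpansion f ds =
  All (λ cg → ValidMon (proj₁ cg) × IsQSym (proj₂ cg)) ds
  × Unique (map proj₁ ds)
  × (∀ m → ValidMon m → f m ≡ foldr (λ cg s → mulMonCoeff (proj₁ cg) (proj₂ cg) m ℚ.+ s) 0ℚ ds)

-- η₀: the coefficient g_1 of the monomial 1 in the expansion (0 if absent)
eta0 : List (Mon × Series) → Series
eta0 [] = λ _ → 0ℚ
eta0 (([] , g) ∷ _) = g
eta0 ((_ ∷ _ , _) ∷ ds) = eta0 ds

placeMinus : List ℕ → Mon
placeMinus [] = []
placeMinus (a ∷ as) = ((- (+ length as)) , a) ∷ placeMinus as

-- g(x_+): the image of g ∈ QSym(x_-) in QSym(x_+), M_α ↦ M_α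
toPlus : Series → Series
toPlus g m = if ⌊ all? (λ i → + 1 ℤ.≤? i) (indices m) ⌋ then g (placeMinus (exps m)) else 0ℚ

-- γ^b : x_i ↦ x_{i+b}
shiftPow : ℕ → Series → Series
shiftPow b f m = f (map (λ ia → (proj₁ ia ℤ.- + b , proj₂ ia)) m)

piPlus : Series → Series
piPlus f m = if ⌊ all? (λ i → + 1 ℤ.≤? i) (indices m) ⌋ then f m else 0ℚ

-- For large b the monomial m shifted down by b lies strictly to the left of the
-- leading variable of every non-constant x^c in the expansion f = Σ g_c x^c, so no
-- such x^c divides it and the coefficient of f there is that of g_1 = η₀(f) alone.
-- Since the shifted monomial also lies in x_-, quasisymmetry of η₀(f) identifies
-- that coefficient with the one at the canonical placement of exps m, which is
-- the coefficient of m in η₀(f)(x_+).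

module Submission where

open import Defs
open import Data.Nat using (ℕ; _≤_)
open import Data.List using (List)
open import Data.Product using (_×_; ∃)
open import Relation.Binary.PropositionalEquality using (_≡_)

import Data.Nat as ℕ
import Data.Nat.Properties as ℕ
open import Data.Integer as ℤ using (ℤ; +_; -[1+_]; -_)
import Data.Integer.Properties as ℤ
open import Data.Integer.Tactic.RingSolver using (solve-∀)
open import Data.Rational as ℚ using (0ℚ)
import Data.Rational.Properties as ℚ
open import Data.List using ([]; _∷_; map; foldr; length)
open import Data.List.Relation.Unary.All as All using (All; []; _∷_)
open import Data.List.Relation.Unary.All.Properties using (map⁺; map⁻)
open import Data.List.Relation.Unary.AllPairs using (_∷_)
open import Data.List.Relation.Unary.Unique.Propositional using (Unique)
open import Data.Product using (_,_; proj₁; proj₂)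
import Data.Maybe as Maybe
open import Data.Maybe using (nothing)
open import Data.Unit using (tt)
open import Data.Bool using (if_then_else_)
open import Function using (_∘_)
open import Relation.Nullary using (¬_; yes; no; contradiction)
open import Relation.Binary.PropositionalEquality using (refl; sym; trans; cong; cong₂; module ≡-Reasoning)

Eventually : (ℕ → Set) → Set
Eventually P = ∃ λ B → ∀ b → B ≤ b → P b

eventually-map : {P Q : ℕ → Set} → (∀ {b} → P b → Q b) → Eventually P → Eventually Q
eventually-map f (B , h) = B , λ b B≤b → f (h b B≤b)

eventually-× : {P Q : ℕ → Set} → Eventually P → Eventually Q → Eventually (λ b → P b × Q b)
eventually-× (B , p) (C , q) = B ℕ.⊔ C , λ b le →
  p b (ℕ.≤-trans (ℕ.m≤m⊔n B C) le) , q b (ℕ.≤-trans (ℕ.m≤n⊔m B C) le)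

eventually-all : {A : Set} {P : A → ℕ → Set} {xs : List A}
  → All (λ x → Eventually (P x)) xs → Eventually (λ b → All (λ x → P x b) xs)
eventually-all []       = 0 , λ _ _ → []
eventually-all (p ∷ ps) = eventually-map (λ (h , hs) → h ∷ hs) (eventually-× p (eventually-all ps))

i≤+∣i∣ : ∀ i → i ℤ.≤ + ℤ.∣ i ∣
i≤+∣i∣ (+ n)    = ℤ.≤-refl
i≤+∣i∣ -[1+ n ] = ℤ.-≤+

eventually-i-b≤ : ∀ i t → Eventually (λ b → i ℤ.- + b ℤ.≤ t)
eventually-i-b≤ i t = ℤ.∣ d ∣ , λ b ∣d∣≤b → begin
  i ℤ.- + b               ≤⟨ ℤ.+-monoʳ-≤ i (ℤ.neg-mono-≤ (ℤ.+≤+ ∣d∣≤b)) ⟩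
  i ℤ.- + ℤ.∣ d ∣          ≡⟨ regroup i t (+ ℤ.∣ d ∣) ⟩
  t ℤ.+ (d ℤ.- + ℤ.∣ d ∣)  ≤⟨ ℤ.+-monoʳ-≤ t (ℤ.i≤j⇒i-j≤0 (i≤+∣i∣ d)) ⟩
  t ℤ.+ + 0               ≡⟨ ℤ.+-identityʳ t ⟩
  t                       ∎
  where
  open ℤ.≤-Reasoning
  d = i ℤ.- t
  regroup : ∀ i t x → i ℤ.- x ≡ t ℤ.+ ((i ℤ.- t) ℤ.- x)
  regroup = solve-∀

shiftDown : ℕ → Mon → Mon
shiftDown b = map (λ ia → (proj₁ ia ℤ.- + b , proj₂ ia))

shiftDown-valid : ∀ b m → ValidMon m → ValidMon (shiftDown b m)
shiftDown-valid b []                      _              = tt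
shiftDown-valid b ((i , a) ∷ [])          (a≥1 , _ , _)  = a≥1 , tt , tt
shiftDown-valid b ((i , a) ∷ (j , _) ∷ m) (a≥1 , i<j , v) =
  a≥1 , ℤ.+-monoˡ-< (- + b) i<j , shiftDown-valid b ((j , _) ∷ m) v

exps-shiftDown : ∀ b m → exps (shiftDown b m) ≡ exps m
exps-shiftDown b []            = refl
exps-shiftDown b ((_ , a) ∷ m) = cong (a ∷_) (exps-shiftDown b m)

eventually-shiftDown-≤ : ∀ t m → Eventually (λ b → All (ℤ._≤ t) (indices (shiftDown b m)))
eventually-shiftDown-≤ t m =
  eventually-map (map⁺ ∘ map⁺) (eventually-all (All.universal (λ ia → eventually-i-b≤ (proj₁ ia) t) m))

exps-placeMinus : ∀ as → exps (placeMinus as) ≡ as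
exps-placeMinus []       = refl
exps-placeMinus (a ∷ as) = cong (a ∷_) (exps-placeMinus as)

placeMinus-valid : ∀ as → All (1 ℕ.≤_) as → ValidMon (placeMinus as)
placeMinus-valid []            _            = tt
placeMinus-valid (a ∷ [])      (a≥1 ∷ _)    = a≥1 , tt , tt
placeMinus-valid (a ∷ a′ ∷ as) (a≥1 ∷ as≥1) =
  a≥1 , ℤ.neg-mono-< (ℤ.+<+ (ℕ.n<1+n (length as))) , placeMinus-valid (a′ ∷ as) as≥1

placeMinus-nonpositive : ∀ as → All (ℤ._≤ + 0) (indices (placeMinus as))
placeMinus-nonpositive []       = []
placeMinus-nonpositive (a ∷ as) = ℤ.neg-mono-≤ (ℤ.+≤+ ℕ.z≤n) ∷ placeMinus-nonpositive as

exps-positive : ∀ m → ValidMon m → All (1 ℕ.≤_) (exps m)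
exps-positive []            _             = []
exps-positive ((_ , a) ∷ m) (a≥1 , _ , v) = a≥1 ∷ exps-positive m v

divMon-below-lead : ∀ {t} m j e c → All (ℤ._≤ t) (indices m) → t ℤ.< j
  → divMon m ((j , e) ∷ c) ≡ nothing
divMon-below-lead []            j e c _          _   = refl
divMon-below-lead ((i , a) ∷ m) j e c (i≤t ∷ m≤t) t<j with i ℤ.<? j | i ℤ.≟ j
... | yes _ | _   = cong (Maybe.map ((i , a) ∷_)) (divMon-below-lead m j e c m≤t t<j)
... | no i≮j | _  = contradiction (ℤ.≤-<-trans i≤t t<j) i≮j

mulMonCoeff-below-lead : ∀ {t} c g m → All (ℤ._≤ t) (indices m) → Above t c → ¬ [] ≡ c
  → mulMonCoeff c g m ≡ 0ℚ
mulMonCoeff-below-lead []            g m _   _   c≢[] = contradiction refl c≢[]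
mulMonCoeff-below-lead ((j , e) ∷ c) g m m≤t t<j _    =
  cong (Maybe.maybe g 0ℚ) (divMon-below-lead m j e c m≤t t<j)

expansionCoeff : List (Mon × Series) → Series
expansionCoeff ds m = foldr (λ cg s → mulMonCoeff (proj₁ cg) (proj₂ cg) m ℚ.+ s) 0ℚ ds

LeadsAbove : ℤ → List (Mon × Series) → Set
LeadsAbove t = All (Above t ∘ proj₁)

expansionCoeff-below-leads : ∀ {t} ds m → All (ℤ._≤ t) (indices m) → LeadsAbove t ds
  → All (λ cg → ¬ [] ≡ proj₁ cg) ds → expansionCoeff ds m ≡ 0ℚ
expansionCoeff-below-leads []             m _   _              _              = refl
expansionCoeff-below-leads ((c , g) ∷ ds) m m≤t (c-above ∷ above) (c≢[] ∷ ≢[]) = begin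
  mulMonCoeff c g m ℚ.+ expansionCoeff ds m
    ≡⟨ cong₂ ℚ._+_ (mulMonCoeff-below-lead c g m m≤t c-above c≢[])
                   (expansionCoeff-below-leads ds m m≤t above ≢[]) ⟩
  0ℚ ℚ.+ 0ℚ
    ≡⟨ ℚ.+-identityˡ 0ℚ ⟩
  0ℚ ∎
  where open ≡-Reasoning

expansionCoeff-eta0 : ∀ {t} ds m → All (ℤ._≤ t) (indices m) → LeadsAbove t ds
  → Unique (map proj₁ ds) → expansionCoeff ds m ≡ eta0 ds m
expansionCoeff-eta0 [] m _ _ _ = refl
expansionCoeff-eta0 (([] , g) ∷ ds) m m≤t (_ ∷ above) ([]-fresh ∷ _) =
  trans (cong (g m ℚ.+_) (expansionCoeff-below-leads ds m m≤t above (map⁻ []-fresh))) (ℚ.+-identityʳ (g m))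
expansionCoeff-eta0 ((c@(_ ∷ _) , g) ∷ ds) m m≤t (c-above ∷ above) (_ ∷ distinct) =
  trans (cong₂ ℚ._+_ (mulMonCoeff-below-lead c g m m≤t c-above λ ()) (expansionCoeff-eta0 ds m m≤t above distinct))
        (ℚ.+-identityˡ (eta0 ds m))

Above-anti : ∀ {s t} m → s ℤ.≤ t → Above t m → Above s m
Above-anti []      _   _   = tt
Above-anti (_ ∷ _) s≤t t<j = ℤ.≤-<-trans s≤t t<j

leadsAbove-bound : ∀ ds → ∃ λ t → t ℤ.≤ + 0 × LeadsAbove t ds
leadsAbove-bound [] = + 0 , ℤ.≤-refl , []
leadsAbove-bound ((c , g) ∷ ds) with leadsAbove-bound ds
... | t , t≤0 , above = t ℤ.⊓ lower c , ℤ.≤-trans (ℤ.i⊓j≤i t _) t≤0 ,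
  below-lower c ∷ All.map (λ {cg} → Above-anti (proj₁ cg) (ℤ.i⊓j≤i t (lower c))) above
  where
  lower : Mon → ℤ
  lower []            = t
  lower ((j , _) ∷ _) = ℤ.pred j
  below-lower : ∀ c → Above (t ℤ.⊓ lower c) c
  below-lower []            = tt
  below-lower ((j , _) ∷ _) = ℤ.i≤pred[j]⇒i<j (ℤ.i⊓j≤j t (ℤ.pred j))

QuasiSymmetric : Series → Set
QuasiSymmetric g = ∀ m m′ → ValidMon m → ValidMon m′
  → All (ℤ._≤ + 0) (indices m) → All (ℤ._≤ + 0) (indices m′)
  → exps m ≡ exps m′ → g m ≡ g m′

eta0-quasiSymmetric : ∀ ds → All (IsQSym ∘ proj₂) ds → QuasiSymmetric (eta0 ds)
eta0-quasiSymmetric []                   _                 _ _ _ _ _ _ _ = refl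
eta0-quasiSymmetric (([] , g) ∷ ds)      ((_ , _ , qs) ∷ _) = qs
eta0-quasiSymmetric ((_ ∷ _ , _) ∷ ds)   (_ ∷ qsyms)        = eta0-quasiSymmetric ds qsyms

eventually-shiftDown-eta0 : ∀ f ds → IsQSymExpansion f ds → ∀ m → ValidMon m
  → Eventually (λ b → f (shiftDown b m) ≡ eta0 ds (placeMinus (exps m)))
eventually-shiftDown-eta0 f ds (summands , distinct , expand) m valid with leadsAbove-bound ds
... | t , t≤0 , above = eventually-map shifted-coeff (eventually-shiftDown-≤ t m)
  where
  open ≡-Reasoning
  shifted-coeff : ∀ {b} → All (ℤ._≤ t) (indices (shiftDown b m))
    → f (shiftDown b m) ≡ eta0 ds (placeMinus (exps m))
  shifted-coeff {b} below-t = begin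
    f (shiftDown b m)
      ≡⟨ expand (shiftDown b m) (shiftDown-valid b m valid) ⟩
    expansionCoeff ds (shiftDown b m)
      ≡⟨ expansionCoeff-eta0 ds (shiftDown b m) below-t above distinct ⟩
    eta0 ds (shiftDown b m)
      ≡⟨ eta0-quasiSymmetric ds (All.map proj₂ summands) _ _
           (shiftDown-valid b m valid) (placeMinus-valid _ (exps-positive m valid))
           (All.map (λ i≤t → ℤ.≤-trans i≤t t≤0) below-t) (placeMinus-nonpositive _)
           (trans (exps-shiftDown b m) (sym (exps-placeMinus (exps m)))) ⟩
    eta0 ds (placeMinus (exps m)) ∎

-- π₊ and (·)(x₊) test the same positivity condition on m, so only the branches are compared.
-- Back quasisymmetry only serves to guarantee that the expansion exists, so it is unused here.
proposition4p5 : (f : Series) → IsBackQR f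
    → (ds : List (Mon × Series)) → IsQSymExpansion f ds
    → ∀ m → ValidMon m
    → ∃ λ B → ∀ (b : ℕ) → B ≤ b → piPlus (shiftPow b f) m ≡ toPlus (eta0 ds) m
proposition4p5 f _ ds expansion m valid =
  eventually-map (cong (λ x → if _ then x else 0ℚ)) (eventually-shiftDown-eta0 f ds expansion m valid)
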